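{- (1) Let $p$ be a strongly admissible pattern and let $m$ be a $p$-admissible multiplicity. Then the set of all numerical semigroups with multiplicity $m$ admitting $p$ is an $m$-variety. (2) Let $p_1,\dots,p_r$ be strongly admissible patterns and let $m$ be a multiplicity that is $p_i$-admissible for every $i\in\{1,\dots,r\}$. Then the set of all numerical semigroups with multiplicity $m$ admitting simultaneously $p_1,\dots,p_r$ is an $m$-variety.
   Context: A numerical semigroup is a subset $\Lambda\subseteq\mathbb N_0$ containing $0$, closed under addition, with finite complement in $\mathbb N_0$; its multiplicity is its smallest nonzero element; $\mathrm F(\Lambda)$ is the largest integer not in $\Lambda$. $\{0,m,\to\}=\{0\}\cup\{m,m+1,\dots\}$. A (nonhomogeneous) pattern is $p(x_1,\dots,x_n)=\sum_{i=1}^n a_ix_i+a_0$ with $a_1,\dots,a_n$ nonzero integers and $a_0$ a nonzero integer; $\Lambda$ admits $p$ if $p(s_1,\dots,s_n)\in\Lambda$ for all nonzero $s_1\geq\cdots\geq s_n$ in $\Lambda$. Put $\sigma_j=\sum_{i=1}^j a_i$. The pattern $p$ is admissible if $\sigma_j\geq 0$ for all $j\le n$ and either $a_0\geq 0$ or $\sigma_n>1$. A positive integer $m$ is a $p$-admissible multiplicity if $m\geq -a_0/(\sigma_n-1)$ when $\sigma_n>1$, no condition when $\sigma_n=1$, and $m\le a_0$ when $\sigma_n=0$. For an admissible $p$ (so $a_1\geq 1$) define $p'=p-x_1$ if $a_1>1$, and $p'=p(0,x_1,\dots,x_{n-1})$ if $a_1=1$; write $p'=\sum_i a'_ix_i+a_0$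 and $\sigma'_j=\sum_{i=1}^j a'_i$ for the partial sums of its coefficients (for $j$ from $1$ to the number of variables of $p'$). $p$ is strongly admissible if it is admissible and $\sigma'_j\geq 0$ for all such $j$. A set $\mathcal V$ of numerical semigroups all of multiplicity $m$ is an $m$-variety if (V1) $\Lambda_1\cap\Lambda_2\in\mathcal V$ for all $\Lambda_1,\Lambda_2\in\mathcal V$ and (V2) $\Lambda\cup\{\mathrm F(\Lambda)\}\in\mathcal V$ for every $\Lambda\in\mathcal V$ with $\Lambda\ne\{0,m,\to\}$. -}

module Defs where

open import Data.Bool using (Bool; true; false; _∧_; _∨_)
open import Data.Nat as ℕ using (ℕ; zero; suc; _+_; _<_; _≤_; _≥_; _≡ᵇ_; _≤ᵇ_)
open import Data.Integer as ℤ using (ℤ; +_; -[1+_])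
open import Data.List using (List; []; _∷_; length; take; zipWith; foldr)
open import Data.List.Relation.Unary.All using (All)
open import Data.List.Relation.Binary.Pointwise using ()
open import Data.List.Relation.Unary.Linked using (Linked)
open import Data.Product using (_×_; ∃)
open import Relation.Binary.PropositionalEquality using (_≡_; _≢_)
open import Relation.Nullary using (¬_)

sumℤ : List ℤ → ℤ
sumℤ = foldr ℤ._+_ ℤ.0ℤ

SubsetN : Set
SubsetN = ℕ → Bool

_∈ˢ_ : ℕ → SubsetN → Set
n ∈ˢ Λ = Λ n ≡ true

record IsNumSG (Λ : SubsetN) : Set where
  field
    has-zero : 0 ∈ˢ Λ
    closed   : ∀ a b → a ∈ˢ Λ → b ∈ˢ Λ → (a + b) ∈ˢ Λ
    cofinite : ∃ λ N → ∀ n → N ≤ n → n ∈ˢ Λ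

record HasMult (Λ : SubsetN) (m : ℕ) : Set where
  field
    m-pos  : 0 < m
    m-in   : m ∈ˢ Λ
    m-min  : ∀ k → 0 < k → k < m → Λ k ≡ false

ordinary : ℕ → SubsetN
ordinary m n = (n ≡ᵇ 0) ∨ (m ≤ᵇ n)

IsFrobenius : SubsetN → ℕ → Set
IsFrobenius Λ f = (Λ f ≡ false) × (∀ n → f < n → n ∈ˢ Λ)

_∩ˢ_ : SubsetN → SubsetN → SubsetN
(Λ₁ ∩ˢ Λ₂) n = Λ₁ n ∧ Λ₂ n

insertˢ : SubsetN → ℕ → SubsetN
insertˢ Λ f n = Λ n ∨ (n ≡ᵇ f)

record IsVariety (m : ℕ) (V : SubsetN → Set) : Set where
  field
    members : ∀ Λ → V Λ → IsNumSG Λ × HasMult Λ m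
    V1      : ∀ Λ₁ Λ₂ → V Λ₁ → V Λ₂ → V (Λ₁ ∩ˢ Λ₂)
    V2      : ∀ Λ → V Λ → ¬ (∀ n → Λ n ≡ ordinary m n) →
              ∀ f → IsFrobenius Λ f → V (insertˢ Λ f)

_∈ℤ_ : ℤ → SubsetN → Set
(+ n) ∈ℤ Λ = n ∈ˢ Λ
-[1+ _ ] ∈ℤ Λ = ⊥'
  where open import Data.Empty renaming (⊥ to ⊥')

-- A nonhomogeneous pattern p(x₁,…,xₙ) = a₁x₁ + … + aₙxₙ + a₀,
-- with n ≥ 1 and all aᵢ (including a₀) nonzero.
record Pattern : Set where
  constructor pat
  field
    a₁   : ℤ
    rest : List ℤ
    a₀   : ℤ
    coeffs-nonzero : All (_≢ ℤ.0ℤ) (a₁ ∷ rest)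
    a₀-nonzero     : a₀ ≢ ℤ.0ℤ

  coeffs : List ℤ
  coeffs = a₁ ∷ rest

  σn : ℤ
  σn = sumℤ coeffs

  eval : List ℕ → ℤ
  eval s = sumℤ (zipWith (λ a x → a ℤ.* (+ x)) coeffs s) ℤ.+ a₀

open Pattern public

Admits : SubsetN → Pattern → Set
Admits Λ p = ∀ (s : List ℕ) → length s ≡ length (coeffs p) →
             All (λ x → (x ≢ 0) × (x ∈ˢ Λ)) s → Linked _≥_ s →
             eval p s ∈ℤ Λ

PrefixSumsNonneg : List ℤ → Set
PrefixSumsNonneg as = ∀ j → ℤ.0ℤ ℤ.≤ sumℤ (take j as)

Admissible : Pattern → Set
Admissible p = PrefixSumsNonneg (coeffs p) × (ℤ.0ℤ ℤ.≤ a₀ p ⊎' ℤ.1ℤ ℤ.< σn p)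
  where open import Data.Sum renaming (_⊎_ to _⊎'_)

-- coefficients of p': p - x₁ if a₁ > 1, p(0,x₁,…,x_{n-1}) if a₁ = 1
primeCoeffs : Pattern → List ℤ
primeCoeffs p with a₁ p ℤ.≟ ℤ.1ℤ
... | Relation.Nullary.yes _ = rest p
... | Relation.Nullary.no  _ = (a₁ p ℤ.- ℤ.1ℤ) ∷ rest p
  where import Relation.Nullary

StronglyAdmissible : Pattern → Set
StronglyAdmissible p = Admissible p × PrefixSumsNonneg (primeCoeffs p)

-- m is a p-admissible multiplicity (m positive);
-- σₙ > 1: m ≥ -a₀/(σₙ-1), written as m·(σₙ-1) ≥ -a₀ (σₙ-1 > 0);
-- σₙ = 0: m ≤ a₀.
AdmissibleMult : Pattern → ℕ → Set
AdmissibleMult p m =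
  (0 < m) ×
  (ℤ.1ℤ ℤ.< σn p → ℤ.- a₀ p ℤ.≤ (+ m) ℤ.* (σn p ℤ.- ℤ.1ℤ)) ×
  (σn p ≡ ℤ.0ℤ → (+ m) ℤ.≤ a₀ p)

AdmitsAll : ℕ → List Pattern → SubsetN → Set
AdmitsAll m ps Λ = IsNumSG Λ × HasMult Λ m × All (Admits Λ) ps

AdmitsOne : ℕ → Pattern → SubsetN → Set
AdmitsOne m p Λ = IsNumSG Λ × HasMult Λ m × Admits Λ p

-- The semigroups of multiplicity m admitting p are closed
-- under intersection (admission is checked pointwise, and an intersection
-- has fewer tuples to check), and under adjoining the Frobenius number F.
-- For the latter, take a decreasing tuple s₁ ≥ ⋯ ≥ sₙ of nonzero elements
-- of Λ ∪ {F}.  If s₁ < F the whole tuple lies in Λ, so p(s) ∈ Λ.  If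
-- s₁ ≥ F we show p(s) ≥ s₁ ≥ F, so p(s) ∈ Λ ∪ {F}.  Writing
-- p(s) = s₁ + p′(s) (with p′ the shifted pattern, whose coefficients sum to
-- σₙ - 1 and have nonnegative partial sums), Abel summation over the
-- decreasing tuple, whose entries are all ≥ m, gives p′(s) ≥ (σₙ - 1)·m + a₀,
-- and admissibility of p and m makes this constant nonnegative.
module Submission where

open import Defs
open import Data.Bool using (true; false; _∧_; _∨_; T)
open import Data.Bool.Properties using (∨-zeroʳ)
open import Data.Nat as ℕ using (ℕ; zero; suc; _≡ᵇ_; z≤n; s≤s)
import Data.Nat.Properties as ℕP
open import Data.Integer as ℤ using (ℤ; +_; _+_; _*_; _-_; -_; 0ℤ; 1ℤ; _≤_; _<_; +≤+)
import Data.Integer.Properties as ℤP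
open import Data.Integer.Tactic.RingSolver using (solve-∀)
open import Data.List using (List; []; _∷_; length; take; zipWith)
open import Data.List.Properties using (take-all)
open import Data.List.Relation.Unary.All as All using (All; []; _∷_)
open import Data.List.Relation.Unary.Linked using (Linked; _∷_)
open import Data.List.Relation.Unary.Linked.Properties using (Linked⇒All)
open import Data.Product using (_×_; _,_; proj₁; proj₂)
open import Data.Sum using (_⊎_; inj₁; inj₂)
open import Data.Empty using (⊥-elim)
open import Relation.Binary.PropositionalEquality
open import Relation.Nullary using (¬_; yes; no)

dot : List ℤ → List ℕ → ℤ
dot cs t = sumℤ (zipWith (λ a x → a * + x) cs t)

*-monoˡ-≤-0≤ : ∀ {a : ℤ} {x y : ℕ} → 0ℤ ≤ a → x ℕ.≤ y → a * + x ≤ a * + y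
*-monoˡ-≤-0≤ {+ n} _ x≤y = ℤP.*-monoˡ-≤-nonNeg (+ n) (+≤+ x≤y)

sum-nonneg : ∀ cs → PrefixSumsNonneg cs → 0ℤ ≤ sumℤ cs
sum-nonneg cs prefix =
  subst (λ l → 0ℤ ≤ sumℤ l) (take-all (length cs) cs ℕP.≤-refl) (prefix (length cs))

accumulator-nonneg : ∀ A cs → (∀ j → 0ℤ ≤ A + sumℤ (take j cs)) → 0ℤ ≤ A
accumulator-nonneg A cs prefix = subst (0ℤ ≤_) (ℤP.+-identityʳ A) (prefix 0)

-- Abel summation, with an accumulated partial sum A of earlier coefficients:
-- if every A + σⱼ is ≥ 0 and u ≥ t₁ ≥ t₂ ≥ ⋯ ≥ m, then
-- (A + Σ cs)·m ≤ A·u + Σ cᵢtᵢ.  The accumulator makes the induction go through.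
abel-bound : ∀ (A : ℤ) (u m : ℕ) (cs : List ℤ) (t : List ℕ) →
             length t ≡ length cs → (∀ j → 0ℤ ≤ A + sumℤ (take j cs)) →
             Linked ℕ._≥_ (u ∷ t) → m ℕ.≤ u → All (m ℕ.≤_) t →
             (A + sumℤ cs) * + m ≤ A * + u + dot cs t
abel-bound A u m [] [] _ prefix _ m≤u _ = begin
  (A + 0ℤ) * + m   ≡⟨ cong (_* + m) (ℤP.+-identityʳ A) ⟩
  A * + m          ≤⟨ *-monoˡ-≤-0≤ (accumulator-nonneg A [] prefix) m≤u ⟩
  A * + u          ≡⟨ sym (ℤP.+-identityʳ (A * + u)) ⟩
  A * + u + 0ℤ     ∎
  where open ℤP.≤-Reasoning
abel-bound A u m (c ∷ cs) (t₁ ∷ t) len prefix (t₁≤u ∷ linked) m≤u (m≤t₁ ∷ m≤t) = begin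
  (A + (c + sumℤ cs)) * + m          ≡⟨ cong (_* + m) (sym (ℤP.+-assoc A c (sumℤ cs))) ⟩
  (A + c + sumℤ cs) * + m            ≤⟨ abel-bound (A + c) t₁ m cs t (ℕP.suc-injective len)
                                          prefix′ linked m≤t₁ m≤t ⟩
  (A + c) * + t₁ + dot cs t          ≡⟨ regroup A c (+ t₁) (dot cs t) ⟩
  A * + t₁ + (c * + t₁ + dot cs t)   ≤⟨ ℤP.+-monoˡ-≤ (c * + t₁ + dot cs t)
                                          (*-monoˡ-≤-0≤ (accumulator-nonneg A (c ∷ cs) prefix) t₁≤u) ⟩
  A * + u + (c * + t₁ + dot cs t)    ∎
  where
  open ℤP.≤-Reasoning
  prefix′ : ∀ j → 0ℤ ≤ A + c + sumℤ (take j cs)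
  prefix′ j = subst (0ℤ ≤_) (sym (ℤP.+-assoc A c (sumℤ (take j cs)))) (prefix (suc j))
  regroup : ∀ A c t Z → (A + c) * t + Z ≡ A * t + (c * t + Z)
  regroup = solve-∀

weighted-sum-bound : ∀ (u m : ℕ) (cs : List ℤ) (t : List ℕ) →
                     length t ≡ length cs → PrefixSumsNonneg cs →
                     Linked ℕ._≥_ (u ∷ t) → m ℕ.≤ u → All (m ℕ.≤_) t →
                     sumℤ cs * + m ≤ dot cs t
weighted-sum-bound u m cs t len prefix linked m≤u m≤t =
  subst₂ _≤_ (cong (_* + m) (ℤP.+-identityˡ (sumℤ cs))) (ℤP.+-identityˡ (dot cs t))
    (abel-bound 0ℤ u m cs t len prefix₀ linked m≤u m≤t)
  where
  prefix₀ : ∀ j → 0ℤ ≤ 0ℤ + sumℤ (take j cs)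
  prefix₀ j = subst (0ℤ ≤_) (sym (ℤP.+-identityˡ _)) (prefix j)

-- The constant (σ - 1)·m + a₀ is nonnegative when σ ≥ 1, when either a₀ ≥ 0
-- or σ > 1 (admissibility of p), and when σ > 1 forces m·(σ - 1) ≥ -a₀
-- (admissibility of m).
shifted-constant-nonneg : ∀ (σ a : ℤ) (m : ℕ) → 0ℤ ≤ σ - 1ℤ → (0ℤ ≤ a ⊎ 1ℤ < σ) →
                          (1ℤ < σ → - a ≤ + m * (σ - 1ℤ)) → 0ℤ ≤ (σ - 1ℤ) * + m + a
shifted-constant-nonneg σ a m σ≥1 (inj₁ a≥0) _ = ℤP.+-mono-≤ product≥0 a≥0
  where
  product≥0 : 0ℤ ≤ (σ - 1ℤ) * + m
  product≥0 = subst (_≤ (σ - 1ℤ) * + m) (ℤP.*-zeroʳ (σ - 1ℤ)) (*-monoˡ-≤-0≤ σ≥1 z≤n)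
shifted-constant-nonneg σ a m _ (inj₂ σ>1) m-bound = begin
  0ℤ                    ≡⟨ sym (ℤP.+-inverseˡ a) ⟩
  - a + a               ≤⟨ ℤP.+-monoˡ-≤ a (m-bound σ>1) ⟩
  + m * (σ - 1ℤ) + a    ≡⟨ cong (_+ a) (ℤP.*-comm (+ m) (σ - 1ℤ)) ⟩
  (σ - 1ℤ) * + m + a    ∎
  where open ℤP.≤-Reasoning

-- The arguments of the shifted pattern p′ (see primeCoeffs): p′ drops x₁
-- when a₁ = 1 and keeps it (with coefficient a₁ - 1) otherwise.
primeArgs : Pattern → ℕ → List ℕ → List ℕ
primeArgs p s₁ s with a₁ p ℤ.≟ 1ℤ
... | yes _ = s
... | no _  = s₁ ∷ s

-- p(s₁, s) = s₁ + p′(s₁, s): this is what the shift from p to p′ is for.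
eval-prime : ∀ p s₁ s →
             eval p (s₁ ∷ s) ≡ + s₁ + dot (primeCoeffs p) (primeArgs p s₁ s) + a₀ p
eval-prime p s₁ s with a₁ p ℤ.≟ 1ℤ
... | yes a₁≡1 = cong (λ x → x + dot (rest p) s + a₀ p)
                      (trans (cong (_* + s₁) a₁≡1) (ℤP.*-identityˡ (+ s₁)))
... | no _     = split-first (a₁ p) (+ s₁) (dot (rest p) s) (a₀ p)
  where split-first : ∀ a x T b → a * x + T + b ≡ x + ((a - 1ℤ) * x + T) + b
        split-first = solve-∀

primeCoeffs-sum : ∀ p → sumℤ (primeCoeffs p) ≡ σn p - 1ℤ
primeCoeffs-sum p with a₁ p ℤ.≟ 1ℤ
... | yes a₁≡1 = trans (add-sub-one (sumℤ (rest p)))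
                       (cong (λ a → a + sumℤ (rest p) - 1ℤ) (sym a₁≡1))
  where add-sub-one : ∀ x → x ≡ 1ℤ + x - 1ℤ
        add-sub-one = solve-∀
... | no _     = move-one (a₁ p) (sumℤ (rest p))
  where move-one : ∀ a x → (a - 1ℤ) + x ≡ a + x - 1ℤ
        move-one = solve-∀

primeArgs-length : ∀ p s₁ s → length (s₁ ∷ s) ≡ length (coeffs p) →
                   length (primeArgs p s₁ s) ≡ length (primeCoeffs p)
primeArgs-length p s₁ s len with a₁ p ℤ.≟ 1ℤ
... | yes _ = ℕP.suc-injective len
... | no _  = len

primeArgs-all : ∀ {P : ℕ → Set} p s₁ s → All P (s₁ ∷ s) → All P (primeArgs p s₁ s)
primeArgs-all p s₁ s (Ps₁ ∷ Ps) with a₁ p ℤ.≟ 1ℤ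
... | yes _ = Ps
... | no _  = Ps₁ ∷ Ps

primeArgs-linked : ∀ p s₁ s → Linked ℕ._≥_ (s₁ ∷ s) → Linked ℕ._≥_ (s₁ ∷ primeArgs p s₁ s)
primeArgs-linked p s₁ s linked with a₁ p ℤ.≟ 1ℤ
... | yes _ = linked
... | no _  = ℕP.≤-refl ∷ linked

-- The key estimate: for strongly admissible p and p-admissible m, every
-- decreasing tuple s₁ ≥ ⋯ ≥ sₙ ≥ m satisfies p(s) ≥ s₁, since
-- p(s) = s₁ + p′(s) ≥ s₁ + (σₙ - 1)·m + a₀ ≥ s₁.
eval-lower-bound : ∀ {p m} → StronglyAdmissible p → AdmissibleMult p m →
                   ∀ s₁ s → length (s₁ ∷ s) ≡ length (coeffs p) →
                   All (m ℕ.≤_) (s₁ ∷ s) → Linked ℕ._≥_ (s₁ ∷ s) → + s₁ ≤ eval p (s₁ ∷ s)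
eval-lower-bound {p} {m} ((_ , a₀-or-σ) , prime-prefix) (_ , m-bound , _)
                 s₁ s len m≤s linked = begin
  + s₁                                 ≡⟨ sym (ℤP.+-identityʳ (+ s₁)) ⟩
  + s₁ + 0ℤ                            ≤⟨ ℤP.+-monoʳ-≤ (+ s₁) constant≥0 ⟩
  + s₁ + ((σn p - 1ℤ) * + m + a₀ p)    ≤⟨ ℤP.+-monoʳ-≤ (+ s₁) (ℤP.+-monoˡ-≤ (a₀ p) shifted≥) ⟩
  + s₁ + (dot pc t + a₀ p)             ≡⟨ sym (ℤP.+-assoc (+ s₁) (dot pc t) (a₀ p)) ⟩
  + s₁ + dot pc t + a₀ p               ≡⟨ sym (eval-prime p s₁ s) ⟩
  eval p (s₁ ∷ s)                      ∎
  where
  open ℤP.≤-Reasoning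
  pc = primeCoeffs p
  t  = primeArgs p s₁ s
  σ≥1 : 0ℤ ≤ σn p - 1ℤ
  σ≥1 = subst (0ℤ ≤_) (primeCoeffs-sum p) (sum-nonneg pc prime-prefix)
  constant≥0 : 0ℤ ≤ (σn p - 1ℤ) * + m + a₀ p
  constant≥0 = shifted-constant-nonneg (σn p) (a₀ p) m σ≥1 a₀-or-σ m-bound
  shifted≥ : (σn p - 1ℤ) * + m ≤ dot pc t
  shifted≥ = subst (λ σ′ → σ′ * + m ≤ dot pc t) (primeCoeffs-sum p)
               (weighted-sum-bound s₁ m pc t (primeArgs-length p s₁ s len) prime-prefix
                  (primeArgs-linked p s₁ s linked) (All.head m≤s) (primeArgs-all p s₁ s m≤s))

T⇒≡true : ∀ {b} → T b → b ≡ true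
T⇒≡true {true} _ = refl

¬T⇒≡false : ∀ {b} → ¬ T b → b ≡ false
¬T⇒≡false {false} _ = refl
¬T⇒≡false {true} ¬t = ⊥-elim (¬t _)

∧-true : ∀ {a b} → a ≡ true → b ≡ true → (a ∧ b) ≡ true
∧-true refl refl = refl

∧-true⁻ : ∀ {a b} → (a ∧ b) ≡ true → a ≡ true × b ≡ true
∧-true⁻ {true} {true} _ = refl , refl

∈ℤ-mono : ∀ {Λ Λ′} → (∀ {x} → x ∈ˢ Λ → x ∈ˢ Λ′) → ∀ {z} → z ∈ℤ Λ → z ∈ℤ Λ′
∈ℤ-mono Λ⊆Λ′ {+ n} z∈Λ = Λ⊆Λ′ z∈Λ

∩-numSG : ∀ {Λ₁ Λ₂} → IsNumSG Λ₁ → IsNumSG Λ₂ → IsNumSG (Λ₁ ∩ˢ Λ₂)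
∩-numSG sg₁ sg₂ = record
  { has-zero = ∧-true (IsNumSG.has-zero sg₁) (IsNumSG.has-zero sg₂)
  ; closed   = λ a b a∈ b∈ →
      let (a∈₁ , a∈₂) = ∧-true⁻ a∈ ; (b∈₁ , b∈₂) = ∧-true⁻ b∈
      in ∧-true (IsNumSG.closed sg₁ a b a∈₁ b∈₁) (IsNumSG.closed sg₂ a b a∈₂ b∈₂)
  ; cofinite = N₁ ℕ.+ N₂ , λ n N≤n →
      ∧-true (above₁ n (ℕP.≤-trans (ℕP.m≤m+n N₁ N₂) N≤n))
             (above₂ n (ℕP.≤-trans (ℕP.m≤n+m N₂ N₁) N≤n))
  }
  where
  N₁ = proj₁ (IsNumSG.cofinite sg₁)
  N₂ = proj₁ (IsNumSG.cofinite sg₂)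
  above₁ = proj₂ (IsNumSG.cofinite sg₁)
  above₂ = proj₂ (IsNumSG.cofinite sg₂)

∩-mult : ∀ {Λ₁ Λ₂ m} → HasMult Λ₁ m → HasMult Λ₂ m → HasMult (Λ₁ ∩ˢ Λ₂) m
∩-mult {Λ₂ = Λ₂} hm₁ hm₂ = record
  { m-pos = HasMult.m-pos hm₁
  ; m-in  = ∧-true (HasMult.m-in hm₁) (HasMult.m-in hm₂)
  ; m-min = λ k k>0 k<m → cong (_∧ Λ₂ k) (HasMult.m-min hm₁ k k>0 k<m)
  }

∩-admits : ∀ {Λ₁ Λ₂ p} → Admits Λ₁ p → Admits Λ₂ p → Admits (Λ₁ ∩ˢ Λ₂) p
∩-admits {Λ₁} {Λ₂} {p} admits₁ admits₂ s len elems linked = both (eval p s)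
  (admits₁ s len (All.map (λ (nz , x∈) → nz , proj₁ (∧-true⁻ x∈)) elems) linked)
  (admits₂ s len (All.map (λ (nz , x∈) → nz , proj₂ (∧-true⁻ x∈)) elems) linked)
  where
  both : ∀ z → z ∈ℤ Λ₁ → z ∈ℤ Λ₂ → z ∈ℤ (Λ₁ ∩ˢ Λ₂)
  both (+ n) = ∧-true

module Insertion (Λ : SubsetN) (f : ℕ) where

  ∈⇒∈insert : ∀ {x} → x ∈ˢ Λ → x ∈ˢ insertˢ Λ f
  ∈⇒∈insert {x} x∈Λ = cong (_∨ (x ≡ᵇ f)) x∈Λ

  f∈insert : f ∈ˢ insertˢ Λ f
  f∈insert = trans (cong (Λ f ∨_) (T⇒≡true (ℕP.≡⇒≡ᵇ f f refl))) (∨-zeroʳ (Λ f))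

  ∈insert⇒∈ : ∀ {x} → x ∈ˢ insertˢ Λ f → x ≢ f → x ∈ˢ Λ
  ∈insert⇒∈ {x} x∈ x≢f with Λ x
  ... | true  = refl
  ... | false = ⊥-elim (x≢f (ℕP.≡ᵇ⇒≡ x f (subst T (sym x∈) _)))

module FrobeniusInsertion {Λ : SubsetN} {F : ℕ} (frob : IsFrobenius Λ F) where

  open Insertion Λ F

  ≥F⇒∈insert : ∀ {z} → + F ≤ z → z ∈ℤ insertˢ Λ F
  ≥F⇒∈insert {+ n} (+≤+ F≤n) with F ℕP.≟ n
  ... | yes refl = f∈insert
  ... | no F≢n   = ∈⇒∈insert (proj₂ frob n (ℕP.≤∧≢⇒< F≤n F≢n))

  -- Λ ∪ {F} is a numerical semigroup: a sum of two nonzero elements either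
  -- exceeds F, or both summands are below F and hence lie in Λ.
  insert-numSG : IsNumSG Λ → IsNumSG (insertˢ Λ F)
  insert-numSG sg = record
    { has-zero = ∈⇒∈insert (IsNumSG.has-zero sg)
    ; closed   = closed
    ; cofinite = suc F , λ n F<n → ∈⇒∈insert (proj₂ frob n F<n)
    }
    where
    closed : ∀ a b → a ∈ˢ insertˢ Λ F → b ∈ˢ insertˢ Λ F → (a ℕ.+ b) ∈ˢ insertˢ Λ F
    closed zero b _ b∈ = b∈
    closed (suc a) zero a∈ _ = subst (_∈ˢ insertˢ Λ F) (sym (ℕP.+-identityʳ (suc a))) a∈
    closed (suc a) (suc b) a∈ b∈ with F ℕP.<? suc a ℕ.+ suc b
    ... | yes F<sum = ∈⇒∈insert (proj₂ frob _ F<sum)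
    ... | no F≮sum  = ∈⇒∈insert (IsNumSG.closed sg (suc a) (suc b)
          (summand∈Λ a∈ (ℕP.m<m+n (suc a) (s≤s z≤n)))
          (summand∈Λ b∈ (ℕP.m<n+m (suc b) (s≤s z≤n))))
      where
      summand∈Λ : ∀ {x} → x ∈ˢ insertˢ Λ F → x ℕ.< suc a ℕ.+ suc b → x ∈ˢ Λ
      summand∈Λ x∈ x<sum = ∈insert⇒∈ x∈ (λ x≡F → F≮sum (subst (ℕ._< suc a ℕ.+ suc b) x≡F x<sum))

  frobenius<mult⇒ordinary : ∀ {m} → IsNumSG Λ → HasMult Λ m → F ℕ.< m →
                            ∀ n → Λ n ≡ ordinary m n
  frobenius<mult⇒ordinary sg hm F<m zero = IsNumSG.has-zero sg
  frobenius<mult⇒ordinary {m} sg hm F<m (suc k) with m ℕP.≤? suc k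
  ... | yes m≤n = trans (proj₂ frob (suc k) (ℕP.<-≤-trans F<m m≤n))
                        (sym (T⇒≡true (ℕP.≤⇒≤ᵇ m≤n)))
  ... | no m≰n  = trans (HasMult.m-min hm (suc k) (s≤s z≤n) (ℕP.≰⇒> m≰n))
                        (sym (¬T⇒≡false (λ t → m≰n (ℕP.≤ᵇ⇒≤ m (suc k) t))))

  module _ {m : ℕ} (sg : IsNumSG Λ) (hm : HasMult Λ m)
           (not-ordinary : ¬ (∀ n → Λ n ≡ ordinary m n)) where

    mult≤frobenius : m ℕ.≤ F
    mult≤frobenius with m ℕP.≤? F
    ... | yes m≤F = m≤F
    ... | no m≰F  = ⊥-elim (not-ordinary (frobenius<mult⇒ordinary sg hm (ℕP.≰⇒> m≰F)))

    -- Since F ≥ m, adjoining F creates no new element below m.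
    insert-mult : HasMult (insertˢ Λ F) m
    insert-mult = record
      { m-pos = HasMult.m-pos hm
      ; m-in  = ∈⇒∈insert (HasMult.m-in hm)
      ; m-min = λ k k>0 k<m → trans (cong (_∨ (k ≡ᵇ F)) (HasMult.m-min hm k k>0 k<m))
                  (¬T⇒≡false (λ t → ℕP.<⇒≱ k<m (subst (m ℕ.≤_) (sym (ℕP.≡ᵇ⇒≡ k F t)) mult≤frobenius)))
      }

    insert-nonzero⇒≥mult : ∀ {x} → x ≢ 0 → x ∈ˢ insertˢ Λ F → m ℕ.≤ x
    insert-nonzero⇒≥mult {x} x≢0 x∈ with x ℕP.≟ F | m ℕP.≤? x
    ... | yes refl | _       = mult≤frobenius
    ... | no _     | yes m≤x = m≤x
    ... | no x≢F   | no m≰x  with trans (sym (∈insert⇒∈ x∈ x≢F))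
                                       (HasMult.m-min hm x (ℕP.n≢0⇒n>0 x≢0) (ℕP.≰⇒> m≰x))
    ...   | ()

    -- Admission of p survives adjoining F: tuples with s₁ ≥ F have p(s) ≥ s₁ ≥ F
    -- by the key estimate, tuples with s₁ < F lie in Λ.
    insert-admits : ∀ {p} → StronglyAdmissible p → AdmissibleMult p m →
                    Admits Λ p → Admits (insertˢ Λ F) p
    insert-admits sa am admits [] () elems linked
    insert-admits {p} sa am admits (s₁ ∷ s) len elems linked with F ℕP.≤? s₁
    ... | yes F≤s₁ = ≥F⇒∈insert (ℤP.≤-trans (+≤+ F≤s₁)
          (eval-lower-bound sa am s₁ s len
             (All.map (λ (x≢0 , x∈) → insert-nonzero⇒≥mult x≢0 x∈) elems) linked))
    ... | no F≰s₁  = ∈ℤ-mono ∈⇒∈insert (admits (s₁ ∷ s) len elems-in-Λ linked)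
      where
      elems-in-Λ : All (λ x → (x ≢ 0) × (x ∈ˢ Λ)) (s₁ ∷ s)
      elems-in-Λ = All.zipWith
        (λ ((x≢0 , x∈) , x≤s₁) → x≢0 , ∈insert⇒∈ x∈ (λ x≡F → F≰s₁ (subst (ℕ._≤ s₁) x≡F x≤s₁)))
        (elems , Linked⇒All (λ y≤x z≤y → ℕP.≤-trans z≤y y≤x) ℕP.≤-refl linked)

variety-cong : ∀ {m} {V W : SubsetN → Set} → (∀ {Λ} → V Λ → W Λ) → (∀ {Λ} → W Λ → V Λ) →
               IsVariety m V → IsVariety m W
variety-cong V⇒W W⇒V isVariety = record
  { members = λ Λ w → members Λ (W⇒V w)
  ; V1      = λ Λ₁ Λ₂ w₁ w₂ → V⇒W (V1 Λ₁ Λ₂ (W⇒V w₁) (W⇒V w₂))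
  ; V2      = λ Λ w not-ordinary f frob → V⇒W (V2 Λ (W⇒V w) not-ordinary f frob)
  }
  where open IsVariety isVariety

admitsAll-variety : ∀ (ps : List Pattern) (m : ℕ) → All StronglyAdmissible ps →
                    All (λ p → AdmissibleMult p m) ps → IsVariety m (AdmitsAll m ps)
admitsAll-variety ps m strong mults = record
  { members = λ Λ (sg , hm , _) → sg , hm
  ; V1      = λ Λ₁ Λ₂ (sg₁ , hm₁ , admits₁) (sg₂ , hm₂ , admits₂) →
      ∩-numSG sg₁ sg₂ , ∩-mult hm₁ hm₂ ,
      All.zipWith (λ {p} (a₁ , a₂) → ∩-admits {p = p} a₁ a₂) (admits₁ , admits₂)
  ; V2      = λ Λ (sg , hm , admits) not-ordinary F frob →
      let open FrobeniusInsertion frob in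
      insert-numSG sg , insert-mult sg hm not-ordinary ,
      All.zipWith (λ ((sa , am) , a) → insert-admits sg hm not-ordinary sa am a)
                  (All.zip (strong , mults) , admits)
  }

mainTheorem4 :
    (∀ (p : Pattern) (m : ℕ) → StronglyAdmissible p → AdmissibleMult p m →
       IsVariety m (AdmitsOne m p))
    ×
    (∀ (ps : List Pattern) (m : ℕ) → All StronglyAdmissible ps →
       All (λ p → AdmissibleMult p m) ps →
       IsVariety m (AdmitsAll m ps))
mainTheorem4 = single , admitsAll-variety
  where
  single : ∀ (p : Pattern) (m : ℕ) → StronglyAdmissible p → AdmissibleMult p m →
           IsVariety m (AdmitsOne m p)
  single p m sa am = variety-cong (λ (sg , hm , admits) → sg , hm , All.head admits)
                                  (λ (sg , hm , admits) → sg , hm , admits ∷ [])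
                                  (admitsAll-variety (p ∷ []) m (sa ∷ []) (am ∷ []))
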